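{- Let $S=\{R_0,\ldots,R_d\}$ be an association scheme on a nonempty finite set $X$, $\mathbb{F}$ a field, $x\in X$, $a\ge 0$ an integer, and $i_b,j_b,\ell_b\in\{0,\ldots,d\}$ for $b=0,\ldots,a$ such that $p_{i_bj_b}^{\ell_b}=1$ and $k_{i_b}=k_{\ell_b}=2$ for all $b\in\{0,\ldots,a\}$ and $\ell_c=i_{c+1}$ for all $c\in\{0,\ldots,a-1\}$. Write $xR_{i_0}=\{u_1,u_2\}$ and $xR_{\ell_a}=\{v_1,v_2\}$. Then $P=E_{i_0}^*A_{j_0}E_{\ell_0}^*E_{i_1}^*A_{j_1}E_{\ell_1}^*\cdots E_{i_a}^*A_{j_a}E_{\ell_a}^*$ satisfies $P=E_{u_1v_1}+E_{u_2v_2}$ or $P=E_{u_1v_2}+E_{u_2v_1}$.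
   Context: An association scheme on $X$ is a partition $S=\{R_0,\ldots,R_d\}$ of $X\times X$ into nonempty relations with $R_0$ the diagonal, closed under transposes, with intersection numbers $p_{ij}^k=|\{\ell:(m,\ell)\in R_i,(\ell,n)\in R_j\}|$ independent of $(m,n)\in R_k$. Valency $k_a=|xR_a|$, $xR_a=\{z:(x,z)\in R_a\}$. $A_j\in M_X(\mathbb{F})$ is the $(0,1)$ adjacency matrix of $R_j$, $E_i^*$ the diagonal $(0,1)$-matrix with $(y,y)$-entry $1$ iff $y\in xR_i$, and $E_{uv}$ the matrix unit whose only nonzero entry is a $1$ in position $(u,v)$. -}

module Defs where

open import Level using (Level; _⊔_) renaming (suc to lsuc)
open import Data.Nat using (ℕ; zero; suc) renaming (_+_ to _+ℕ_)
open import Data.Fin using (Fin; zero; suc; _≟_)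
open import Data.Bool using (Bool; true; false; if_then_else_; _∧_)
open import Data.Product using (Σ; ∃; ∃₂; _×_; _,_)
open import Relation.Nullary using (¬_)
open import Relation.Nullary.Decidable using (⌊_⌋)
open import Relation.Binary.PropositionalEquality using (_≡_)
open import Algebra.Bundles using (CommutativeRing)

count : ∀ {n} → (Fin n → Bool) → ℕ
count {zero} f = 0
count {suc n} f = (if f zero then 1 else 0) +ℕ count {n} (λ z → f (suc z))

record Field (c ℓ : Level) : Set (lsuc (c ⊔ ℓ)) where
  field
    commutativeRing : CommutativeRing c ℓ
  open CommutativeRing commutativeRing public
  field
    1≉0 : ¬ (1# ≈ 0#)
    inverse : ∀ x → ¬ (x ≈ 0#) → ∃ λ y → x * y ≈ 1#

-- An association scheme on X = Fin n with classes R_0 , … , R_d.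
-- rel m l = i  means  (m , l) ∈ R_i  (so the R_i partition X × X).
record AssocScheme (n : ℕ) : Set where
  field
    d   : ℕ
    rel : Fin n → Fin n → Fin (suc d)
    nonempty : ∀ i → ∃₂ λ m l → rel m l ≡ i
    diag⇒ : ∀ m l → rel m l ≡ zero → m ≡ l
    ⇒diag : ∀ m l → m ≡ l → rel m l ≡ zero
    transp : ∀ i → Σ (Fin (suc d)) λ i' →
               ∀ m l → (rel m l ≡ i → rel l m ≡ i') × (rel l m ≡ i' → rel m l ≡ i)
    p : Fin (suc d) → Fin (suc d) → Fin (suc d) → ℕ
    p-spec : ∀ i j k m l → rel m l ≡ k →
               count (λ z → ⌊ rel m z ≟ i ⌋ ∧ ⌊ rel z l ≟ j ⌋) ≡ p i j k

  valency : Fin n → Fin (suc d) → ℕ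
  valency x i = count (λ z → ⌊ rel x z ≟ i ⌋)

module Matrices {c ℓ : Level} (F : Field c ℓ) (n : ℕ) where
  open Field F using (Carrier; _≈_; _+_; _*_; 0#; 1#)

  Mat : Set c
  Mat = Fin n → Fin n → Carrier

  Σ[_] : ∀ {m} → (Fin m → Carrier) → Carrier
  Σ[_] {zero} f = 0#
  Σ[_] {suc m} f = f zero + Σ[_] {m} (λ z → f (suc z))

  _⊗_ : Mat → Mat → Mat
  (M ⊗ N) r s = Σ[ (λ t → M r t * N t s) ]

  _⊕_ : Mat → Mat → Mat
  (M ⊕ N) r s = M r s + N r s

  _≋_ : Mat → Mat → Set ℓ
  M ≋ N = ∀ r s → M r s ≈ N r s

  χ : Bool → Carrier
  χ true = 1#
  χ false = 0#

  Eunit : Fin n → Fin n → Mat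
  Eunit u v r s = χ (⌊ r ≟ u ⌋ ∧ ⌊ s ≟ v ⌋)

  chain : (a : ℕ) → (Fin (suc a) → Mat) → Mat
  chain zero M = M zero
  chain (suc a) M = M zero ⊗ chain a (λ b → M (suc b))

  module _ (S : AssocScheme n) where
    open AssocScheme S

    Adj : Fin (suc d) → Mat
    Adj j r s = χ ⌊ rel r s ≟ j ⌋

    Estar : Fin n → Fin (suc d) → Mat
    Estar x i r s = χ (⌊ r ≟ s ⌋ ∧ ⌊ rel x r ≟ i ⌋)

-- The (r, s) entry of E*_i A_j E*_l is 1 exactly when r ∈ xR_i, (r, s) ∈ R_j and s ∈ xR_l.
-- Since p_{ij}^l = 1, each of the two points of xR_l has exactly one R_j-predecessor in
-- xR_i; and since every r ∈ xR_i has the same number p_{lj'}^i of R_j-successors in xR_l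
-- (j' the transpose of j), these two predecessors are different. Hence each factor is the
-- permutation matrix of a bijection xR_{i_b} → xR_{l_b}, and as xR_{l_b} = xR_{i_{b+1}} the
-- product is the permutation matrix of a bijection xR_{i_0} → xR_{l_a}.
module Submission where

open import Defs
open import Level using (Level)
open import Data.Nat using (ℕ; zero; suc) renaming (_+_ to _+ℕ_)
open import Data.Nat.Properties using (+-suc; suc-injective)
open import Data.Fin using (Fin; zero; suc; _≟_; inject₁; fromℕ)
open import Data.Fin.Properties using () renaming (suc-injective to Fin-suc-injective)
open import Data.Bool using (Bool; true; false; T; not; _∧_; if_then_else_)
open import Data.Empty using (⊥-elim)
open import Data.Product using (∃; ∃₂; ∃!; _×_; _,_; proj₁; proj₂)
open import Data.Sum using (_⊎_; inj₁; inj₂; [_,_])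
open import Function using (_∘_)
open import Relation.Nullary using (¬_; Dec; yes; no)
open import Relation.Nullary.Decidable using (⌊_⌋; _×-dec_; toWitness; fromWitness)
open import Relation.Binary.PropositionalEquality
  using (_≡_; refl; sym; trans; cong; cong₂; subst; module ≡-Reasoning)

count-cong : ∀ {m} {g h : Fin m → Bool} → (∀ z → g z ≡ h z) → count g ≡ count h
count-cong {zero} _ = refl
count-cong {suc m} g≗h =
  cong₂ (λ b k → (if b then 1 else 0) +ℕ k) (g≗h zero) (count-cong (g≗h ∘ suc))

count-witness : ∀ {m} (g : Fin m → Bool) {k} → count g ≡ suc k → ∃ λ z → T (g z)
count-witness {suc m} g eq with g zero in g₀
... | true = zero , subst T (sym g₀) _
... | false with count-witness (g ∘ suc) eq
...   | z , t = suc z , t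

remove : ∀ {m} → Fin m → (Fin m → Bool) → Fin m → Bool
remove z g w = not ⌊ w ≟ z ⌋ ∧ g w

T-remove : ∀ {m} {z w : Fin m} (g : Fin m → Bool) → ¬ w ≡ z → T (g w) → T (remove z g w)
T-remove {z = z} {w} g w≢z t with w ≟ z
... | yes w≡z = ⊥-elim (w≢z w≡z)
... | no _ = t

T-remove⁻ : ∀ {m} {z w : Fin m} (g : Fin m → Bool) → T (remove z g w) → ¬ w ≡ z × T (g w)
T-remove⁻ {z = z} {w} g t with w ≟ z
... | no w≢z = w≢z , t

remove-suc : ∀ {m} (z : Fin m) (g : Fin (suc m) → Bool) w → remove (suc z) g (suc w) ≡ remove z (g ∘ suc) w
remove-suc z g w with w ≟ z | suc w ≟ suc z
... | yes _ | yes _ = refl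
... | no _ | no _ = refl
... | yes w≡z | no sw≢sz = ⊥-elim (sw≢sz (cong suc w≡z))
... | no w≢z | yes sw≡sz = ⊥-elim (w≢z (Fin-suc-injective sw≡sz))

count-remove : ∀ {m} (g : Fin m → Bool) (z : Fin m) → T (g z) → count g ≡ suc (count (remove z g))
count-remove {suc m} g zero t with g zero
... | true = refl
count-remove {suc m} g (suc z) t = begin
  c₀ +ℕ count (g ∘ suc)                   ≡⟨ cong (c₀ +ℕ_) (count-remove (g ∘ suc) z t) ⟩
  c₀ +ℕ suc (count (remove z (g ∘ suc)))  ≡⟨ +-suc c₀ _ ⟩
  suc (c₀ +ℕ count (remove z (g ∘ suc)))  ≡⟨ cong (λ k → suc (c₀ +ℕ k)) (count-cong (sym ∘ remove-suc z g)) ⟩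
  suc (count (remove (suc z) g))         ∎
  where
  open ≡-Reasoning
  c₀ = if g zero then 1 else 0

count≡0⇒¬T : ∀ {m} (g : Fin m → Bool) → count g ≡ 0 → ∀ z → ¬ T (g z)
count≡0⇒¬T g c≡0 z t with () ← trans (sym (count-remove g z t)) c≡0

count≡1⇒unique : ∀ {m} (g : Fin m → Bool) → count g ≡ 1 → ∀ {z z'} → T (g z) → T (g z') → z' ≡ z
count≡1⇒unique g c≡1 {z} {z'} t t' with z' ≟ z
... | yes z'≡z = z'≡z
... | no z'≢z = ⊥-elim (count≡0⇒¬T (remove z g) rest≡0 z' (T-remove g z'≢z t'))
  where rest≡0 = suc-injective (trans (sym (count-remove g z t)) c≡1)

toWitness-∧ : ∀ {p q} {A : Set p} {B : Set q} (a? : Dec A) (b? : Dec B) → T (⌊ a? ⌋ ∧ ⌊ b? ⌋) → A × B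
toWitness-∧ (yes a) (yes b) _ = a , b

fromWitness-∧ : ∀ {p q} {A : Set p} {B : Set q} (a? : Dec A) (b? : Dec B) → A × B → T (⌊ a? ⌋ ∧ ⌊ b? ⌋)
fromWitness-∧ (yes _) (yes _) _ = _
fromWitness-∧ (no ¬a) _ (a , _) = ¬a a
fromWitness-∧ (yes _) (no ¬b) (_ , b) = ¬b b

record IsPair {m} (P : Fin m → Set) (z₁ z₂ : Fin m) : Set where
  field
    distinct : ¬ z₁ ≡ z₂
    holds₁ : P z₁
    holds₂ : P z₂
    only : ∀ z → P z → z ≡ z₁ ⊎ z ≡ z₂

IsPair-swap : ∀ {m} {P : Fin m → Set} {z₁ z₂} → IsPair P z₁ z₂ → IsPair P z₂ z₁
IsPair-swap Z = record
  { distinct = distinct ∘ sym ; holds₁ = holds₂ ; holds₂ = holds₁ ; only = λ z → [ inj₂ , inj₁ ] ∘ only z }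
  where open IsPair Z

IsPair-outside : ∀ {m} {P : Fin m → Set} {z₁ z₂} → IsPair P z₁ z₂ → ∀ {z} → ¬ z ≡ z₁ → ¬ z ≡ z₂ → ¬ P z
IsPair-outside Z z≢z₁ z≢z₂ Pz = [ z≢z₁ , z≢z₂ ] (IsPair.only Z _ Pz)

IsPair-map : ∀ {m} {P Q : Fin m → Set} {z₁ z₂} → (∀ {z} → P z → Q z) → (∀ {z} → Q z → P z) →
  IsPair P z₁ z₂ → IsPair Q z₁ z₂
IsPair-map P⇒Q Q⇒P Z = record
  { distinct = distinct ; holds₁ = P⇒Q holds₁ ; holds₂ = P⇒Q holds₂ ; only = λ z → only z ∘ Q⇒P }
  where open IsPair Z

IsPair-with-remainder : ∀ {m} (g : Fin m → Bool) {z₁} → T (g z₁) → count (remove z₁ g) ≡ 1 →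
  ∃ (IsPair (T ∘ g) z₁)
IsPair-with-remainder g {z₁} t₁ rest≡1 with count-witness (remove z₁ g) rest≡1
... | z₂ , t₂ with T-remove⁻ g t₂
...   | z₂≢z₁ , t₂' = z₂ , record { distinct = z₂≢z₁ ∘ sym ; holds₁ = t₁ ; holds₂ = t₂' ; only = only }
  where
  only : ∀ z → T (g z) → z ≡ z₁ ⊎ z ≡ z₂
  only z t with z ≟ z₁
  ... | yes z≡z₁ = inj₁ z≡z₁
  ... | no z≢z₁ = inj₂ (count≡1⇒unique (remove z₁ g) rest≡1 t₂ (T-remove g z≢z₁ t))

count≡2⇒IsPair : ∀ {m} (g : Fin m → Bool) → count g ≡ 2 → ∃₂ (IsPair (T ∘ g))
count≡2⇒IsPair g c≡2 with count-witness g c≡2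
... | z₁ , t₁ = z₁ , IsPair-with-remainder g t₁ (suc-injective (trans (sym (count-remove g z₁ t₁)) c≡2))

module Matchings {c ℓ : Level} (F : Field c ℓ) (n : ℕ) where
  open Field F using (Carrier; _≈_; _+_; _*_; 0#; 1#; +-cong; *-cong;
    setoid; *-assoc; zeroˡ; zeroʳ; *-identityˡ; +-identityˡ; +-identityʳ)
    renaming (refl to ≈-refl; sym to ≈-sym; trans to ≈-trans)
  open Matrices F n
  open import Relation.Binary.Reasoning.Setoid setoid

  χ-yes : ∀ {p} {A : Set p} (a? : Dec A) → A → χ ⌊ a? ⌋ ≈ 1#
  χ-yes (yes _) _ = ≈-refl
  χ-yes (no ¬a) a = ⊥-elim (¬a a)

  χ-no : ∀ {p} {A : Set p} (a? : Dec A) → ¬ A → χ ⌊ a? ⌋ ≈ 0#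
  χ-no (yes a) ¬a = ⊥-elim (¬a a)
  χ-no (no _) _ = ≈-refl

  χ-×-dec : ∀ {p q} {A : Set p} {B : Set q} (a? : Dec A) (b? : Dec B) →
    χ ⌊ a? ⌋ * χ ⌊ b? ⌋ ≈ χ ⌊ a? ×-dec b? ⌋
  χ-×-dec (yes _) (yes _) = *-identityˡ 1#
  χ-×-dec (yes _) (no _) = zeroʳ 1#
  χ-×-dec (no _) b? = zeroˡ (χ ⌊ b? ⌋)

  Σ-zero : ∀ {m} (f : Fin m → Carrier) → (∀ t → f t ≈ 0#) → Σ[ f ] ≈ 0#
  Σ-zero {zero} f _ = ≈-refl
  Σ-zero {suc m} f f≈0 = ≈-trans (+-cong (f≈0 zero) (Σ-zero (f ∘ suc) (f≈0 ∘ suc))) (+-identityˡ 0#)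

  Σ-single : ∀ {m} (f : Fin m → Carrier) w → (∀ t → ¬ t ≡ w → f t ≈ 0#) → Σ[ f ] ≈ f w
  Σ-single {suc m} f zero f≈0 =
    ≈-trans (+-cong ≈-refl (Σ-zero (f ∘ suc) (λ t → f≈0 (suc t) λ ()))) (+-identityʳ (f zero))
  Σ-single {suc m} f (suc w) f≈0 =
    ≈-trans (+-cong (f≈0 zero λ ()) (Σ-single (f ∘ suc) w λ t t≢w → f≈0 (suc t) (t≢w ∘ Fin-suc-injective)))
      (+-identityˡ (f (suc w)))

  ⊗-diagonalˡ : ∀ (D M : Mat) r s → (∀ t → ¬ t ≡ r → D r t ≈ 0#) → (D ⊗ M) r s ≈ D r r * M r s
  ⊗-diagonalˡ D M r s D≈0 = Σ-single _ r λ t t≢r → ≈-trans (*-cong (D≈0 t t≢r) ≈-refl) (zeroˡ (M t s))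

  ⊗-diagonalʳ : ∀ (M D : Mat) r s → (∀ t → ¬ t ≡ s → D t s ≈ 0#) → (M ⊗ D) r s ≈ M r s * D s s
  ⊗-diagonalʳ M D r s D≈0 = Σ-single _ s λ t t≢s → ≈-trans (*-cong ≈-refl (D≈0 t t≢s)) (zeroʳ (M r t))

  record IsMatching (M : Mat) (u₁ u₂ v₁ v₂ : Fin n) : Set ℓ where
    field
      at₁₁ : M u₁ v₁ ≈ 1#
      at₂₂ : M u₂ v₂ ≈ 1#
      at₁₂ : M u₁ v₂ ≈ 0#
      at₂₁ : M u₂ v₁ ≈ 0#
      outside-rows : ∀ r s → ¬ r ≡ u₁ → ¬ r ≡ u₂ → M r s ≈ 0#
      outside-cols : ∀ r s → ¬ s ≡ v₁ → ¬ s ≡ v₂ → M r s ≈ 0#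

  open IsMatching

  IsMatching-swap : ∀ {M u₁ u₂ v₁ v₂} → IsMatching M u₁ u₂ v₁ v₂ → IsMatching M u₂ u₁ v₂ v₁
  IsMatching-swap P = record
    { at₁₁ = at₂₂ P ; at₂₂ = at₁₁ P ; at₁₂ = at₂₁ P ; at₂₁ = at₁₂ P
    ; outside-rows = λ r s r≢u₂ r≢u₁ → outside-rows P r s r≢u₁ r≢u₂
    ; outside-cols = λ r s s≢v₂ s≢v₁ → outside-cols P r s s≢v₁ s≢v₂ }

  IsMatching-⊗-row₁ : ∀ {M u₁ u₂ w₁ w₂} → IsMatching M u₁ u₂ w₁ w₂ → ∀ N s → (M ⊗ N) u₁ s ≈ N w₁ s
  IsMatching-⊗-row₁ {M} {u₁} {u₂} {w₁} {w₂} P N s = begin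
    (M ⊗ N) u₁ s      ≈⟨ Σ-single _ w₁ off-w₁ ⟩
    M u₁ w₁ * N w₁ s  ≈⟨ *-cong (at₁₁ P) ≈-refl ⟩
    1# * N w₁ s       ≈⟨ *-identityˡ (N w₁ s) ⟩
    N w₁ s            ∎
    where
    off-w₁ : ∀ t → ¬ t ≡ w₁ → M u₁ t * N t s ≈ 0#
    off-w₁ t t≢w₁ with t ≟ w₂
    ... | yes refl = ≈-trans (*-cong (at₁₂ P) ≈-refl) (zeroˡ (N t s))
    ... | no t≢w₂ = ≈-trans (*-cong (outside-cols P u₁ t t≢w₁ t≢w₂) ≈-refl) (zeroˡ (N t s))

  IsMatching-⊗ : ∀ {M N u₁ u₂ w₁ w₂ v₁ v₂} →
    IsMatching M u₁ u₂ w₁ w₂ → IsMatching N w₁ w₂ v₁ v₂ → IsMatching (M ⊗ N) u₁ u₂ v₁ v₂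
  IsMatching-⊗ {M} {N} {v₁ = v₁} {v₂} P Q = record
    { at₁₁ = ≈-trans (IsMatching-⊗-row₁ P N v₁) (at₁₁ Q)
    ; at₂₂ = ≈-trans (IsMatching-⊗-row₁ (IsMatching-swap P) N v₂) (at₂₂ Q)
    ; at₁₂ = ≈-trans (IsMatching-⊗-row₁ P N v₂) (at₁₂ Q)
    ; at₂₁ = ≈-trans (IsMatching-⊗-row₁ (IsMatching-swap P) N v₁) (at₂₁ Q)
    ; outside-rows = λ r s r≢u₁ r≢u₂ →
        Σ-zero _ λ t → ≈-trans (*-cong (outside-rows P r t r≢u₁ r≢u₂) ≈-refl) (zeroˡ (N t s))
    ; outside-cols = λ r s s≢v₁ s≢v₂ →
        Σ-zero _ λ t → ≈-trans (*-cong ≈-refl (outside-cols Q t s s≢v₁ s≢v₂)) (zeroʳ (M r t)) }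

  IsMatching-unique : ∀ {M N u₁ u₂ v₁ v₂} → IsMatching M u₁ u₂ v₁ v₂ → IsMatching N u₁ u₂ v₁ v₂ → M ≋ N
  IsMatching-unique {u₁ = u₁} {u₂} {v₁} {v₂} P Q r s with r ≟ u₁ | r ≟ u₂ | s ≟ v₁ | s ≟ v₂
  ... | yes refl | _ | yes refl | _ = ≈-trans (at₁₁ P) (≈-sym (at₁₁ Q))
  ... | yes refl | _ | no _ | yes refl = ≈-trans (at₁₂ P) (≈-sym (at₁₂ Q))
  ... | no _ | yes refl | yes refl | _ = ≈-trans (at₂₁ P) (≈-sym (at₂₁ Q))
  ... | no _ | yes refl | no _ | yes refl = ≈-trans (at₂₂ P) (≈-sym (at₂₂ Q))
  ... | _ | _ | no s≢v₁ | no s≢v₂ =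
    ≈-trans (outside-cols P r s s≢v₁ s≢v₂) (≈-sym (outside-cols Q r s s≢v₁ s≢v₂))
  ... | no r≢u₁ | no r≢u₂ | _ | _ =
    ≈-trans (outside-rows P r s r≢u₁ r≢u₂) (≈-sym (outside-rows Q r s r≢u₁ r≢u₂))

  Eunit-diagonal : ∀ u v → Eunit u v u v ≈ 1#
  Eunit-diagonal u v with u ≟ u | v ≟ v
  ... | yes _ | yes _ = ≈-refl
  ... | no u≢u | _ = ⊥-elim (u≢u refl)
  ... | yes _ | no v≢v = ⊥-elim (v≢v refl)

  Eunit-off-row : ∀ {u v r} s → ¬ r ≡ u → Eunit u v r s ≈ 0#
  Eunit-off-row {u} {r = r} s r≢u with r ≟ u
  ... | yes r≡u = ⊥-elim (r≢u r≡u)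
  ... | no _ = ≈-refl

  Eunit-off-col : ∀ {u v} r {s} → ¬ s ≡ v → Eunit u v r s ≈ 0#
  Eunit-off-col {u} {v} r {s} s≢v with r ≟ u | s ≟ v
  ... | _ | yes s≡v = ⊥-elim (s≢v s≡v)
  ... | yes _ | no _ = ≈-refl
  ... | no _ | no _ = ≈-refl

  Eunit-pair-isMatching : ∀ {u₁ u₂ v₁ v₂} → ¬ u₁ ≡ u₂ → ¬ v₁ ≡ v₂ →
    IsMatching (Eunit u₁ v₁ ⊕ Eunit u₂ v₂) u₁ u₂ v₁ v₂
  Eunit-pair-isMatching {u₁} {u₂} {v₁} {v₂} u₁≢u₂ v₁≢v₂ = record
    { at₁₁ = ≈-trans (+-cong (Eunit-diagonal u₁ v₁) (Eunit-off-row v₁ u₁≢u₂)) (+-identityʳ 1#)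
    ; at₂₂ = ≈-trans (+-cong (Eunit-off-row v₂ (u₁≢u₂ ∘ sym)) (Eunit-diagonal u₂ v₂)) (+-identityˡ 1#)
    ; at₁₂ = zero+zero (Eunit-off-col u₁ (v₁≢v₂ ∘ sym)) (Eunit-off-row v₂ u₁≢u₂)
    ; at₂₁ = zero+zero (Eunit-off-row v₁ (u₁≢u₂ ∘ sym)) (Eunit-off-col u₂ v₁≢v₂)
    ; outside-rows = λ r s r≢u₁ r≢u₂ → zero+zero (Eunit-off-row s r≢u₁) (Eunit-off-row s r≢u₂)
    ; outside-cols = λ r s s≢v₁ s≢v₂ → zero+zero (Eunit-off-col r s≢v₁) (Eunit-off-col r s≢v₂) }
    where
    zero+zero : ∀ {y z} → y ≈ 0# → z ≈ 0# → y + z ≈ 0#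
    zero+zero y≈0 z≈0 = ≈-trans (+-cong y≈0 z≈0) (+-identityˡ 0#)

  Matches : Mat → Fin n → Fin n → Fin n → Fin n → Set ℓ
  Matches M u₁ u₂ v₁ v₂ = IsMatching M u₁ u₂ v₁ v₂ ⊎ IsMatching M u₁ u₂ v₂ v₁

  Matches-⊗ : ∀ {M N u₁ u₂ w₁ w₂ v₁ v₂} →
    Matches M u₁ u₂ w₁ w₂ → Matches N w₁ w₂ v₁ v₂ → Matches (M ⊗ N) u₁ u₂ v₁ v₂
  Matches-⊗ (inj₁ P) (inj₁ Q) = inj₁ (IsMatching-⊗ P Q)
  Matches-⊗ (inj₁ P) (inj₂ Q) = inj₂ (IsMatching-⊗ P Q)
  Matches-⊗ (inj₂ P) (inj₁ Q) = inj₂ (IsMatching-⊗ P (IsMatching-swap Q))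
  Matches-⊗ (inj₂ P) (inj₂ Q) = inj₁ (IsMatching-⊗ P (IsMatching-swap Q))

  Matches⇒≋Eunit : ∀ {M u₁ u₂ v₁ v₂} → ¬ u₁ ≡ u₂ → ¬ v₁ ≡ v₂ → Matches M u₁ u₂ v₁ v₂ →
    M ≋ (Eunit u₁ v₁ ⊕ Eunit u₂ v₂) ⊎ M ≋ (Eunit u₁ v₂ ⊕ Eunit u₂ v₁)
  Matches⇒≋Eunit u₁≢u₂ v₁≢v₂ (inj₁ P) = inj₁ (IsMatching-unique P (Eunit-pair-isMatching u₁≢u₂ v₁≢v₂))
  Matches⇒≋Eunit u₁≢u₂ v₁≢v₂ (inj₂ P) =
    inj₂ (IsMatching-unique P (Eunit-pair-isMatching u₁≢u₂ (v₁≢v₂ ∘ sym)))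

  module _ (S : AssocScheme n) (x : Fin n) where
    open AssocScheme S

    EAE : Fin (suc d) → Fin (suc d) → Fin (suc d) → Mat
    EAE i j l = (Estar S x i ⊗ Adj S j) ⊗ Estar S x l

    Estar-off-diagonal : ∀ i {r t} → ¬ r ≡ t → Estar S x i r t ≈ 0#
    Estar-off-diagonal i {r} {t} r≢t with r ≟ t
    ... | yes r≡t = ⊥-elim (r≢t r≡t)
    ... | no _ = ≈-refl

    Estar-diagonal : ∀ i r → Estar S x i r r ≈ χ ⌊ rel x r ≟ i ⌋
    Estar-diagonal i r with r ≟ r
    ... | yes _ = ≈-refl
    ... | no r≢r = ⊥-elim (r≢r refl)

    edge? : ∀ i j l r s → Dec (rel x r ≡ i × rel r s ≡ j × rel x s ≡ l)
    edge? i j l r s = rel x r ≟ i ×-dec rel r s ≟ j ×-dec rel x s ≟ l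

    EAE-entry : ∀ i j l r s → EAE i j l r s ≈ χ ⌊ edge? i j l r s ⌋
    EAE-entry i j l r s = begin
      EAE i j l r s
        ≈⟨ ⊗-diagonalʳ (Estar S x i ⊗ Adj S j) (Estar S x l) r s (λ _ → Estar-off-diagonal l) ⟩
      (Estar S x i ⊗ Adj S j) r s * Estar S x l s s
        ≈⟨ *-cong (⊗-diagonalˡ (Estar S x i) (Adj S j) r s (λ _ t≢r → Estar-off-diagonal i (t≢r ∘ sym)))
                  (Estar-diagonal l s) ⟩
      (Estar S x i r r * Adj S j r s) * χ ⌊ rel x s ≟ l ⌋
        ≈⟨ *-cong (*-cong (Estar-diagonal i r) ≈-refl) ≈-refl ⟩
      (χ ⌊ rel x r ≟ i ⌋ * χ ⌊ rel r s ≟ j ⌋) * χ ⌊ rel x s ≟ l ⌋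
        ≈⟨ *-assoc _ _ _ ⟩
      χ ⌊ rel x r ≟ i ⌋ * (χ ⌊ rel r s ≟ j ⌋ * χ ⌊ rel x s ≟ l ⌋)
        ≈⟨ *-cong ≈-refl (χ-×-dec (rel r s ≟ j) (rel x s ≟ l)) ⟩
      χ ⌊ rel x r ≟ i ⌋ * χ ⌊ (rel r s ≟ j) ×-dec (rel x s ≟ l) ⌋
        ≈⟨ χ-×-dec (rel x r ≟ i) _ ⟩
      χ ⌊ edge? i j l r s ⌋  ∎

    NeighbourPair : Fin (suc d) → Fin n → Fin n → Set
    NeighbourPair k = IsPair (λ z → rel x z ≡ k)

    valency≡2⇒NeighbourPair : ∀ {k} → valency x k ≡ 2 → ∃₂ (NeighbourPair k)
    valency≡2⇒NeighbourPair {k} k₂ with count≡2⇒IsPair _ k₂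
    ... | z₁ , z₂ , Z =
      z₁ , z₂ , IsPair-map (λ {z} → toWitness {a? = rel x z ≟ k}) (λ {z} → fromWitness {a? = rel x z ≟ k}) Z

    EAE-edge : ∀ {i j l r s} → rel x r ≡ i × rel r s ≡ j × rel x s ≡ l → EAE i j l r s ≈ 1#
    EAE-edge {i} {j} {l} {r} {s} e = ≈-trans (EAE-entry i j l r s) (χ-yes (edge? i j l r s) e)

    EAE-non-edge : ∀ {i j l r s} → ¬ (rel x r ≡ i × rel r s ≡ j × rel x s ≡ l) → EAE i j l r s ≈ 0#
    EAE-non-edge {i} {j} {l} {r} {s} ¬e = ≈-trans (EAE-entry i j l r s) (χ-no (edge? i j l r s) ¬e)

    unique-R-predecessor : ∀ {i j l v} → p i j l ≡ 1 → rel x v ≡ l →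
      ∃! _≡_ λ z → rel x z ≡ i × rel z v ≡ j
    unique-R-predecessor {i} {j} {l} {v} p≡1 xv =
      z , toWitness-∧ (rel x z ≟ i) (rel z v ≟ j) t ,
      λ {w} e → count≡1⇒unique R-predecessor-in-xR_i one (fromWitness-∧ (rel x w ≟ i) (rel w v ≟ j) e) t
      where
      R-predecessor-in-xR_i : Fin n → Bool
      R-predecessor-in-xR_i z = ⌊ rel x z ≟ i ⌋ ∧ ⌊ rel z v ≟ j ⌋
      one : count R-predecessor-in-xR_i ≡ 1
      one = trans (p-spec i j l x v xv) p≡1
      z = proj₁ (count-witness R-predecessor-in-xR_i one)
      t = proj₂ (count-witness R-predecessor-in-xR_i one)

    R-successor-transfer : ∀ {i j l r r' s} → rel x r ≡ i → rel x r' ≡ i → rel x s ≡ l → rel r s ≡ j →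
      ∃ λ s' → rel x s' ≡ l × rel r' s' ≡ j
    R-successor-transfer {i} {j} {l} {r} {r'} {s} xr xr' xs rs =
      let s' , t = count-witness (R-successor-in-xR_l r') r'-count
          xs' , s'r' = toWitness-∧ (rel x s' ≟ l) (rel s' r' ≟ j') t
      in s' , xs' , proj₂ (transpose r' s') s'r'
      where
      j' = proj₁ (transp j)
      transpose = proj₂ (transp j)
      R-successor-in-xR_l : Fin n → Fin n → Bool
      R-successor-in-xR_l w z = ⌊ rel x z ≟ l ⌋ ∧ ⌊ rel z w ≟ j' ⌋
      r-count : count (R-successor-in-xR_l r) ≡ suc _
      r-count = count-remove _ s (fromWitness-∧ (rel x s ≟ l) (rel s r ≟ j') (xs , proj₁ (transpose r s) rs))
      r'-count : count (R-successor-in-xR_l r') ≡ suc _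
      r'-count = trans (p-spec l j' i x r' xr') (trans (sym (p-spec l j' i x r xr)) r-count)

    open IsPair

    R-predecessor-in-pair : ∀ {i j l u₁ u₂ v} → p i j l ≡ 1 → NeighbourPair i u₁ u₂ → rel x v ≡ l →
      (rel u₁ v ≡ j × ¬ rel u₂ v ≡ j) ⊎ (rel u₂ v ≡ j × ¬ rel u₁ v ≡ j)
    R-predecessor-in-pair p≡1 U xv with z , (xz , zv) , unique ← unique-R-predecessor p≡1 xv
      with only U z xz
    ... | inj₁ refl = inj₁ (zv , λ u₂v → distinct U (unique (holds₂ U , u₂v)))
    ... | inj₂ refl = inj₂ (zv , λ u₁v → distinct U (sym (unique (holds₁ U , u₁v))))

    R-successor-in-pair : ∀ {i j l r r' v₁ v₂} → NeighbourPair l v₁ v₂ → rel x r ≡ i → rel x r' ≡ i →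
      rel r v₁ ≡ j → rel r' v₁ ≡ j ⊎ rel r' v₂ ≡ j
    R-successor-in-pair V xr xr' rv₁ with s , xs , r's ← R-successor-transfer xr xr' (holds₁ V) rv₁
      with only V s xs
    ... | inj₁ refl = inj₁ r's
    ... | inj₂ refl = inj₂ r's

    EAE-isMatching : ∀ {i j l u₁ u₂ v₁ v₂} → NeighbourPair i u₁ u₂ → NeighbourPair l v₁ v₂ →
      rel u₁ v₁ ≡ j → rel u₂ v₂ ≡ j → ¬ rel u₁ v₂ ≡ j → ¬ rel u₂ v₁ ≡ j →
      IsMatching (EAE i j l) u₁ u₂ v₁ v₂
    EAE-isMatching U V u₁v₁ u₂v₂ ¬u₁v₂ ¬u₂v₁ = record
      { at₁₁ = EAE-edge (holds₁ U , u₁v₁ , holds₁ V)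
      ; at₂₂ = EAE-edge (holds₂ U , u₂v₂ , holds₂ V)
      ; at₁₂ = EAE-non-edge (¬u₁v₂ ∘ proj₁ ∘ proj₂)
      ; at₂₁ = EAE-non-edge (¬u₂v₁ ∘ proj₁ ∘ proj₂)
      ; outside-rows = λ r s r≢u₁ r≢u₂ →
          EAE-non-edge {r = r} {s} (IsPair-outside U r≢u₁ r≢u₂ ∘ proj₁)
      ; outside-cols = λ r s s≢v₁ s≢v₂ →
          EAE-non-edge {r = r} {s} (IsPair-outside V s≢v₁ s≢v₂ ∘ proj₂ ∘ proj₂) }

    EAE-matches : ∀ {i j l u₁ u₂ v₁ v₂} → p i j l ≡ 1 → NeighbourPair i u₁ u₂ → NeighbourPair l v₁ v₂ →
      Matches (EAE i j l) u₁ u₂ v₁ v₂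
    EAE-matches p≡1 U V
      with R-predecessor-in-pair p≡1 U (holds₁ V) | R-predecessor-in-pair p≡1 U (holds₂ V)
    ... | inj₁ (u₁v₁ , ¬u₂v₁) | inj₂ (u₂v₂ , ¬u₁v₂) = inj₁ (EAE-isMatching U V u₁v₁ u₂v₂ ¬u₁v₂ ¬u₂v₁)
    ... | inj₂ (u₂v₁ , ¬u₁v₁) | inj₁ (u₁v₂ , ¬u₂v₂) =
      inj₂ (EAE-isMatching U (IsPair-swap V) u₁v₂ u₂v₁ ¬u₁v₁ ¬u₂v₂)
    ... | inj₁ (u₁v₁ , ¬u₂v₁) | inj₁ (_ , ¬u₂v₂) =
      ⊥-elim ([ ¬u₂v₁ , ¬u₂v₂ ] (R-successor-in-pair V (holds₁ U) (holds₂ U) u₁v₁))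
    ... | inj₂ (u₂v₁ , ¬u₁v₁) | inj₂ (_ , ¬u₁v₂) =
      ⊥-elim ([ ¬u₁v₁ , ¬u₁v₂ ] (R-successor-in-pair V (holds₂ U) (holds₁ U) u₂v₁))

    chain-matches : ∀ a (i j l : Fin (suc a) → Fin (suc d)) {u₁ u₂ v₁ v₂} →
      (∀ b → p (i b) (j b) (l b) ≡ 1) → (∀ b → valency x (l b) ≡ 2) → (∀ c → l (inject₁ c) ≡ i (suc c)) →
      NeighbourPair (i zero) u₁ u₂ → NeighbourPair (l (fromℕ a)) v₁ v₂ →
      Matches (chain a (λ b → EAE (i b) (j b) (l b))) u₁ u₂ v₁ v₂
    chain-matches zero i j l p≡1 _ _ U V = EAE-matches (p≡1 zero) U V
    chain-matches (suc a) i j l p≡1 k≡2 l≡i U V with w₁ , w₂ , W ← valency≡2⇒NeighbourPair (k≡2 zero) =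
      Matches-⊗ (EAE-matches (p≡1 zero) U W)
        (chain-matches a (i ∘ suc) (j ∘ suc) (l ∘ suc) (p≡1 ∘ suc) (k≡2 ∘ suc) (l≡i ∘ suc)
          (subst (λ k → NeighbourPair k w₁ w₂) (l≡i zero) W) V)

corollary3p9 : ∀ {c ℓ : Level} (F : Field c ℓ) (n : ℕ) (S : AssocScheme n) (x : Fin n) (a : ℕ)
    (i j l : Fin (ℕ.suc a) → Fin (ℕ.suc (AssocScheme.d S))) →
    (∀ b → AssocScheme.p S (i b) (j b) (l b) ≡ 1) →
    (∀ b → AssocScheme.valency S x (i b) ≡ 2) →
    (∀ b → AssocScheme.valency S x (l b) ≡ 2) →
    (∀ (c' : Fin a) → l (inject₁ c') ≡ i (suc c')) →
    (u₁ u₂ v₁ v₂ : Fin n) →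
    ¬ (u₁ ≡ u₂) → (∀ z → AssocScheme.rel S x z ≡ i zero → z ≡ u₁ ⊎ z ≡ u₂) →
    AssocScheme.rel S x u₁ ≡ i zero → AssocScheme.rel S x u₂ ≡ i zero →
    ¬ (v₁ ≡ v₂) → (∀ z → AssocScheme.rel S x z ≡ l (Data.Fin.fromℕ a) → z ≡ v₁ ⊎ z ≡ v₂) →
    AssocScheme.rel S x v₁ ≡ l (Data.Fin.fromℕ a) → AssocScheme.rel S x v₂ ≡ l (Data.Fin.fromℕ a) →
    let open Matrices F n in
    let P = chain a (λ b → (Estar S x (i b) ⊗ Adj S (j b)) ⊗ Estar S x (l b)) in
    (P ≋ (Eunit u₁ v₁ ⊕ Eunit u₂ v₂)) ⊎ (P ≋ (Eunit u₁ v₂ ⊕ Eunit u₂ v₁))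
corollary3p9 F n S x a i j l p≡1 _ k≡2 l≡i u₁ u₂ v₁ v₂ u₁≢u₂ u-only xu₁ xu₂ v₁≢v₂ v-only xv₁ xv₂ =
  Matches⇒≋Eunit u₁≢u₂ v₁≢v₂ (chain-matches S x a i j l p≡1 k≡2 l≡i
    (record { distinct = u₁≢u₂ ; holds₁ = xu₁ ; holds₂ = xu₂ ; only = u-only })
    (record { distinct = v₁≢v₂ ; holds₁ = xv₁ ; holds₂ = xv₂ ; only = v-only }))
  where open Matchings F n
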